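{- Let $G$ be a biconnected graph and let $S=\{a,b\}\in\mathfrak R_2(G)$ be a cutset that is not single. Then $|\mathrm{Part}(S)|=2$, and for each part $A\in\mathrm{Part}(S)$ the graph $G(A)$ is not biconnected and has a cutpoint that separates $a$ from $b$ in $G(A)$.
   Context: All graphs are finite, undirected, without loops or multiple edges; $G(U)$ is the subgraph induced on $U$. A connected component means the vertex set of a maximal connected subgraph. A set $R\subset V(G)$ is a cutset if $G-R$ (delete the vertices of $R$) is disconnected; $\mathfrak R_2(G)$ is the set of 2-vertex cutsets; a cutpoint of a connected graph is a vertex $x$ such that $\{x\}$ is a cutset. $R$ separates $X$ from $Y$ (where $X,Y\not\subset R$) if no vertex of $X\setminus R$ and no vertex of $Y\setminus R$ lie in a common connected component of $G-R$; $R$ splits $X$ if $X\setminus R$ is not contained in one connected component of $G-R$. $G$ is biconnected if $v(G)>2$ and $G$ has no cutset with at most one vertex. Cutsets $S,T\in\mathfrak R_2(G)$ are independent if neither splits the other; $S$ is single if it is independent with all other cutsets in $\mathfrak R_2(G)$. For a cutset $S$, $\mathrm{Part}(S)$ is the set of sets $A\subset V(G)$ not split by $S$ and such that every vertex outside $A$ is separated from $A$ by $S$ (equivalently, the sets $C\cup S$ for $C$ a connected component of $G-S$). -}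

module Defs where

open import Data.Nat using (ℕ; _<_; _≤_)
open import Data.Bool using (Bool; true; false)
open import Data.Fin using (Fin)
open import Data.Fin.Subset public
  using (Subset; _∈_; _∉_; _⊆_; _⊈_; _─_; _∪_; ⁅_⁆; ⊤; ∣_∣)
open import Data.Product using (Σ; ∃; ∃-syntax; _×_)
open import Data.Sum using (_⊎_)
open import Relation.Nullary using (¬_)
open import Relation.Binary.PropositionalEquality using (_≡_; _≢_)

record Graph : Set where
  field
    n     : ℕ
    E     : Fin n → Fin n → Bool
    sym   : ∀ x y → E x y ≡ E y x
    irrefl : ∀ x → E x x ≡ false

module _ (G : Graph) where
  open Graph G

  Adj : Fin n → Fin n → Set
  Adj x y = E x y ≡ true

  data Reach (U : Subset n) : Fin n → Fin n → Set where
    here : ∀ {x} → x ∈ U → Reach U x x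
    step : ∀ {x y z} → x ∈ U → Adj x y → Reach U y z → Reach U x z

  -- All notions below are relative to the induced subgraph G(U);
  -- the graph G itself is G(⊤).

  Connected : Subset n → Set
  Connected U = ∀ x y → x ∈ U → y ∈ U → Reach U x y

  Cutset : Subset n → Subset n → Set
  Cutset U R = R ⊆ U × ∃[ x ] ∃[ y ] (x ∈ U ─ R × y ∈ U ─ R × ¬ Reach (U ─ R) x y)

  Separates : Subset n → Subset n → Subset n → Subset n → Set
  Separates U R X Y =
    X ⊈ R × Y ⊈ R ×
    (∀ x y → x ∈ X ─ R → y ∈ Y ─ R → ¬ Reach (U ─ R) x y)

  Splits : Subset n → Subset n → Subset n → Set
  Splits U R X = ∃[ x ] ∃[ y ] (x ∈ X ─ R × y ∈ X ─ R × ¬ Reach (U ─ R) x y)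

  Biconnected : Subset n → Set
  Biconnected U = 2 < ∣ U ∣ × (∀ R → ∣ R ∣ ≤ 1 → ¬ Cutset U R)

  Cutpoint : Subset n → Fin n → Set
  Cutpoint U x = Connected U × x ∈ U × Cutset U ⁅ x ⁆

  R₂ : Subset n → Set
  R₂ S = Cutset ⊤ S × ∣ S ∣ ≡ 2

  Independent : Subset n → Subset n → Set
  Independent S T = ¬ Splits ⊤ S T × ¬ Splits ⊤ T S

  Single : Subset n → Set
  Single S = ∀ T → R₂ T → T ≢ S → Independent S T

  Part : Subset n → Subset n → Set
  Part S A = ¬ Splits ⊤ S A × (∀ x → x ∉ A → Separates ⊤ S ⁅ x ⁆ A)

  HasExactlyTwo : (Subset n → Set) → Set
  HasExactlyTwo P = ∃[ A₁ ] ∃[ A₂ ]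
    (A₁ ≢ A₂ × P A₁ × P A₂ × (∀ A → P A → A ≡ A₁ ⊎ A ≡ A₂))

module Submission where

-- Key notion: S is crossed by a pair T = {c, d} (c, d ∉ S) if T separates a
-- from b.  Crossing lemma: then every vertex v outside S is joined to c or d
-- in G - S.  Indeed v cannot reach both a and b in G - T, say not x ∈ {a, b};
-- a walk from v to c avoiding the other vertex y of S (G has no cutpoint)
-- meets T before x, and avoids S up to that point.  Consequently, when S is a
-- cutset, it separates c from d, so crossing is symmetric between 2-cutsets.
--
-- Then:
--  * if S is crossed by T, G - S has exactly the two components of c and d,
--    so Part(S) has two elements, and c (resp. d) is a cutpoint of its part
--    separating a from b, since removing it leaves only walks avoiding T;
--  * if S is crossed by no pair, S is single: by the symmetry of crossing no
--    2-cutset T can split S or be split by S.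

open import Defs
open import Data.Fin using (Fin)
open import Data.Product using (∃; ∃-syntax; _×_)
open import Relation.Nullary using (¬_)

open import Data.Empty using (⊥-elim)
open import Data.Fin using (zero; suc) renaming (_≟_ to _≟ᶠ_)
open import Data.Fin.Properties using (any?)
open import Data.Fin.Subset using (_-_; ⊥; inside; outside)
open import Data.Fin.Subset.Properties
  using (_∈?_; ∈⊤; ∣⊥∣≡0; x∈⁅x⁆; x∈⁅y⁆⇒x≡y; x≢y⇒x∉⁅y⁆; x∉⁅y⁆⇒x≢y; ∣⁅x⁆∣≡1; p⊆q⇒∣p∣≤∣q∣;
         x∈p∪q⁻; x∈p∪q⁺; x∈p∧x∉q⇒x∈p─q; x∈p∧x≢y⇒x∈p-y; x∈p⇒∣p-x∣<∣p∣; p─q⊆p; ⊆-antisym)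
open import Data.Nat using (ℕ; _≤_; _<_; s≤s; z≤n)
open import Data.Nat.Properties using (≤-trans; ≤-reflexive; ≤-refl; ≤-pred; <-≤-trans; <⇒≱)
open import Data.Product using (_,_; proj₁; proj₂)
open import Data.Sum using (_⊎_; inj₁; inj₂; [_,_]′)
open import Data.Vec using (_∷_; there; tabulate)
open import Data.Vec.Properties using (lookup∘tabulate; []=⇒lookup; lookup⇒[]=)
open import Data.Bool using (true)
open import Data.Bool.Properties using () renaming (_≟_ to _≟ᴮ_)
open import Relation.Nullary using (Dec; yes; no; does; ¬?)
open import Relation.Nullary.Decidable using (_×-dec_; decidable-stable; dec-true)
open import Relation.Binary.PropositionalEquality using (_≡_; _≢_; refl; sym; trans; subst)

∈─⇒∉ : ∀ {n} (p q : Subset n) {x} → x ∈ p ─ q → x ∉ q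
∈─⇒∉ (_ ∷ p) (inside ∷ q) {zero} ()
∈─⇒∉ (_ ∷ p) (outside ∷ q) {zero} _ ()
∈─⇒∉ (_ ∷ p) (_ ∷ q) {suc x} (there x∈p─q) (there x∈q) = ∈─⇒∉ p q x∈p─q x∈q

∉⇒∈∁ : ∀ {n} {q : Subset n} {x} → x ∉ q → x ∈ ⊤ ─ q
∉⇒∈∁ x∉q = x∈p∧x∉q⇒x∈p─q ∈⊤ x∉q

∈∁⇒∉ : ∀ {n} {q : Subset n} {x} → x ∈ ⊤ ─ q → x ∉ q
∈∁⇒∉ = ∈─⇒∉ ⊤ _

⁅⁆⊆ : ∀ {n} {p : Subset n} {x} → x ∈ p → ⁅ x ⁆ ⊆ p
⁅⁆⊆ {p = p} {x} x∈p z∈⁅x⁆ = subst (_∈ p) (sym (x∈⁅y⁆⇒x≡y x z∈⁅x⁆)) x∈p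

∈⇒1≤∣∣ : ∀ {n} {p : Subset n} {x} → x ∈ p → 1 ≤ ∣ p ∣
∈⇒1≤∣∣ {x = x} x∈p = ≤-trans (≤-reflexive (sym (∣⁅x⁆∣≡1 x))) (p⊆q⇒∣p∣≤∣q∣ (⁅⁆⊆ x∈p))

-- Non-inclusion of finite subsets is witnessed by an element (membership is decidable).
⊈⇒∃ : ∀ {n} {p q : Subset n} → p ⊈ q → ∃[ y ] (y ∈ p × y ∉ q)
⊈⇒∃ {p = p} {q} p⊈q with any? (λ y → y ∈? p ×-dec ¬? (y ∈? q))
... | yes witness = witness
... | no none = ⊥-elim (p⊈q (λ {y} y∈p → decidable-stable (y ∈? q) (λ y∉q → none (y , y∈p , y∉q))))

∣∣<⇒∃ : ∀ {n} {p q : Subset n} → ∣ q ∣ < ∣ p ∣ → ∃[ y ] (y ∈ p × y ∉ q)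
∣∣<⇒∃ q<p = ⊈⇒∃ (λ p⊆q → <⇒≱ q<p (p⊆q⇒∣p∣≤∣q∣ p⊆q))

-- IsPair S a b : S = {a, b} (with a ≡ b allowed).
record IsPair {n} (S : Subset n) (a b : Fin n) : Set where
  field
    members : ∀ {z} → z ∈ S → z ≡ a ⊎ z ≡ b
    left∈   : a ∈ S
    right∈  : b ∈ S
open IsPair

swap : ∀ {n} {S : Subset n} {a b} → IsPair S a b → IsPair S b a
swap P = record { members = λ z∈S → flip (members P z∈S) ; left∈ = right∈ P ; right∈ = left∈ P }
  where
  flip : ∀ {A B : Set} → A ⊎ B → B ⊎ A
  flip (inj₁ x) = inj₂ x
  flip (inj₂ y) = inj₁ y

⁅⁆∪⁅⁆-isPair : ∀ {n} (a b : Fin n) → IsPair (⁅ a ⁆ ∪ ⁅ b ⁆) a b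
⁅⁆∪⁅⁆-isPair a b = record
  { members = λ z∈S → singleton (x∈p∪q⁻ ⁅ a ⁆ ⁅ b ⁆ z∈S)
  ; left∈   = x∈p∪q⁺ (inj₁ (x∈⁅x⁆ a))
  ; right∈  = x∈p∪q⁺ (inj₂ (x∈⁅x⁆ b)) }
  where
  singleton : ∀ {z} → z ∈ ⁅ a ⁆ ⊎ z ∈ ⁅ b ⁆ → z ≡ a ⊎ z ≡ b
  singleton (inj₁ z∈⁅a⁆) = inj₁ (x∈⁅y⁆⇒x≡y a z∈⁅a⁆)
  singleton (inj₂ z∈⁅b⁆) = inj₂ (x∈⁅y⁆⇒x≡y b z∈⁅b⁆)

∉-pair : ∀ {n} {S : Subset n} {a b z} → IsPair S a b → z ≢ a → z ≢ b → z ∉ S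
∉-pair P z≢a z≢b z∈S with members P z∈S
... | inj₁ z≡a = z≢a z≡a
... | inj₂ z≡b = z≢b z≡b

∁⁅⁆∪⁅⁆⊆∁ : ∀ {n} {T : Subset n} {c d} → IsPair T c d → ⊤ ─ (⁅ c ⁆ ∪ ⁅ d ⁆) ⊆ ⊤ ─ T
∁⁅⁆∪⁅⁆⊆∁ {c = c} {d} P z∈ = ∉⇒∈∁ (λ z∈T → ∈∁⇒∉ z∈ (toUnion (members P z∈T)))
  where
  toUnion : ∀ {z} → z ≡ c ⊎ z ≡ d → z ∈ ⁅ c ⁆ ∪ ⁅ d ⁆
  toUnion (inj₁ refl) = left∈ (⁅⁆∪⁅⁆-isPair c d)
  toUnion (inj₂ refl) = right∈ (⁅⁆∪⁅⁆-isPair c d)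

disjoint-pairs : ∀ {n} {S T : Subset n} {a b c d} → IsPair S a b → IsPair T c d →
  c ∉ S → d ∉ S → ∀ {z} → z ∈ S → z ∉ T
disjoint-pairs _ PT c∉S d∉S z∈S z∈T with members PT z∈T
... | inj₁ refl = c∉S z∈S
... | inj₂ refl = d∉S z∈S

∣∣≡2⇒pair : ∀ {n} (T : Subset n) → ∣ T ∣ ≡ 2 → ∃[ c ] ∃[ d ] (c ≢ d × IsPair T c d)
∣∣≡2⇒pair {n} T ∣T∣≡2
  with ∣∣<⇒∃ {q = ⊥} (subst (_< ∣ T ∣) (sym (∣⊥∣≡0 n)) (≤-trans (s≤s z≤n) (≤-reflexive (sym ∣T∣≡2))))
... | c , c∈T , _ with ∣∣<⇒∃ {q = ⁅ c ⁆} (subst (_< ∣ T ∣) (sym (∣⁅x⁆∣≡1 c)) (≤-reflexive (sym ∣T∣≡2)))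
...   | d , d∈T , d∉⁅c⁆ = c , d , c≢d , record { members = only-c-d ; left∈ = c∈T ; right∈ = d∈T }
  where
  c≢d : c ≢ d
  c≢d refl = d∉⁅c⁆ (x∈⁅x⁆ c)
  -- a third element z would give 3 ≤ ∣ T ∣
  only-c-d : ∀ {z} → z ∈ T → z ≡ c ⊎ z ≡ d
  only-c-d {z} z∈T with z ≟ᶠ c | z ≟ᶠ d
  ... | yes z≡c | _ = inj₁ z≡c
  ... | no _ | yes z≡d = inj₂ z≡d
  ... | no z≢c | no z≢d = ⊥-elim (<⇒≱ 3≤∣T∣ (≤-reflexive ∣T∣≡2))
    where
    d∈T-c : d ∈ T - c
    d∈T-c = x∈p∧x≢y⇒x∈p-y d∈T (λ d≡c → c≢d (sym d≡c))
    3≤∣T∣ : 3 ≤ ∣ T ∣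
    3≤∣T∣ = ≤-trans (s≤s (s≤s (∈⇒1≤∣∣ (x∈p∧x≢y⇒x∈p-y (x∈p∧x≢y⇒x∈p-y z∈T z≢c) z≢d))))
              (≤-trans (s≤s (x∈p⇒∣p-x∣<∣p∣ d∈T-c)) (x∈p⇒∣p-x∣<∣p∣ c∈T))

pair-distinct : ∀ {n} {S : Subset n} {a b} → IsPair S a b → ∣ S ∣ ≡ 2 → a ≢ b
pair-distinct {S = S} P ∣S∣≡2 refl with ∣∣≡2⇒pair S ∣S∣≡2
... | c , d , c≢d , Q = c≢d (trans (collapse (members P (left∈ Q))) (sym (collapse (members P (right∈ Q)))))
  where
  collapse : ∀ {z x} → z ≡ x ⊎ z ≡ x → z ≡ x
  collapse (inj₁ e) = e
  collapse (inj₂ e) = e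

module Walks (G : Graph) where
  open Graph G using (n; E) renaming (sym to E-sym)

  adj-sym : ∀ {x y} → Adj G x y → Adj G y x
  adj-sym {x} {y} x~y = trans (E-sym y x) x~y

  start∈ : ∀ {U x y} → Reach G U x y → x ∈ U
  start∈ (here x∈U) = x∈U
  start∈ (step x∈U _ _) = x∈U

  end∈ : ∀ {U x y} → Reach G U x y → y ∈ U
  end∈ (here y∈U) = y∈U
  end∈ (step _ _ walk) = end∈ walk

  reach-mono : ∀ {U V x y} → U ⊆ V → Reach G U x y → Reach G V x y
  reach-mono U⊆V (here x∈U) = here (U⊆V x∈U)
  reach-mono U⊆V (step x∈U x~y walk) = step (U⊆V x∈U) x~y (reach-mono U⊆V walk)

  reach-trans : ∀ {U x y z} → Reach G U x y → Reach G U y z → Reach G U x z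
  reach-trans (here _) walk′ = walk′
  reach-trans (step x∈U x~y walk) walk′ = step x∈U x~y (reach-trans walk walk′)

  reach-snoc : ∀ {U x y z} → Reach G U x y → Adj G y z → z ∈ U → Reach G U x z
  reach-snoc walk y~z z∈U = reach-trans walk (step (end∈ walk) y~z (here z∈U))

  reach-sym : ∀ {U x y} → Reach G U x y → Reach G U y x
  reach-sym (here x∈U) = here x∈U
  reach-sym (step x∈U x~y walk) = reach-snoc (reach-sym walk) (adj-sym x~y) x∈U

  last-visit : ∀ {U u y} x → Reach G U u y →
    Reach G (U - x) u y ⊎ (x ≡ y ⊎ ∃[ z ] (Adj G x z × Reach G (U - x) z y))
  last-visit x (here {u} u∈U) with u ≟ᶠ x
  ... | yes refl = inj₂ (inj₁ refl)
  ... | no u≢x = inj₁ (here (x∈p∧x≢y⇒x∈p-y u∈U u≢x))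
  last-visit x (step {u} {v} u∈U u~v walk) with last-visit x walk
  ... | inj₂ later = inj₂ later
  ... | inj₁ avoiding with u ≟ᶠ x
  ...   | yes refl = inj₂ (inj₂ (v , u~v , avoiding))
  ...   | no u≢x = inj₁ (step (x∈p∧x≢y⇒x∈p-y u∈U u≢x) u~v avoiding)

  -- Reachability is decidable, by induction on the size of U: a walk from x
  -- leaves x once and for all towards a neighbour, inside U - x.
  reach?-bounded : ∀ k U → ∣ U ∣ < k → ∀ x y → Dec (Reach G U x y)
  reach?-bounded ℕ.zero U () x y
  reach?-bounded (ℕ.suc k) U ∣U∣<1+k x y with x ∈? U
  ... | no x∉U = no (λ walk → x∉U (start∈ walk))
  ... | yes x∈U with x ≟ᶠ y
  ...   | yes refl = yes (here x∈U)
  ...   | no x≢y with any? (λ z → (E x z ≟ᴮ true) ×-dec reach?-bounded k (U - x) ∣U-x∣<k z y)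
    where
    ∣U-x∣<k : ∣ U - x ∣ < k
    ∣U-x∣<k = <-≤-trans (x∈p⇒∣p-x∣<∣p∣ x∈U) (≤-pred ∣U∣<1+k)
  ...     | yes (z , x~z , walk) = yes (step x∈U x~z (reach-mono (p─q⊆p U ⁅ x ⁆) walk))
  ...     | no no-neighbour = no unreachable
    where
    unreachable : ¬ Reach G U x y
    unreachable walk with last-visit x walk
    ... | inj₁ avoiding = ∈─⇒∉ U ⁅ x ⁆ (start∈ avoiding) (x∈⁅x⁆ x)
    ... | inj₂ (inj₁ x≡y) = x≢y x≡y
    ... | inj₂ (inj₂ (z , x~z , walk′)) = no-neighbour (z , x~z , walk′)

  reach? : ∀ U x y → Dec (Reach G U x y)
  reach? U x y = reach?-bounded (ℕ.suc ∣ U ∣) U ≤-refl x y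

  first-entry : ∀ {U X v w} → Reach G U v w → v ∉ X → w ∈ X →
    ∃[ z ] ∃[ y ] (z ∈ X × Reach G (U ─ X) v y × Adj G y z)
  first-entry (here _) v∉X w∈X = ⊥-elim (v∉X w∈X)
  first-entry {X = X} (step {v} {v′} v∈U v~v′ walk) v∉X w∈X with v′ ∈? X
  ... | yes v′∈X = v′ , v , v′∈X , here (x∈p∧x∉q⇒x∈p─q v∈U v∉X) , v~v′
  ... | no v′∉X with first-entry walk v′∉X w∈X
  ...   | z , y , z∈X , walk′ , y~z = z , y , z∈X , step (x∈p∧x∉q⇒x∈p─q v∈U v∉X) v~v′ walk′ , y~z

  pair-unsplit : ∀ {X R a b} → IsPair X a b →
    (a ∉ R → b ∉ R → ¬ ¬ Reach G (⊤ ─ R) a b) → ¬ Splits G ⊤ R X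
  pair-unsplit P joined (x , y , x∈ , y∈ , ¬x→y) with members P (p─q⊆p _ _ x∈) | members P (p─q⊆p _ _ y∈)
  ... | inj₁ refl | inj₁ refl = ¬x→y (here (∉⇒∈∁ (∈─⇒∉ _ _ x∈)))
  ... | inj₂ refl | inj₂ refl = ¬x→y (here (∉⇒∈∁ (∈─⇒∉ _ _ x∈)))
  ... | inj₁ refl | inj₂ refl = joined (∈─⇒∉ _ _ x∈) (∈─⇒∉ _ _ y∈) ¬x→y
  ... | inj₂ refl | inj₁ refl = joined (∈─⇒∉ _ _ y∈) (∈─⇒∉ _ _ x∈) (λ y→x → ¬x→y (reach-sym y→x))

  abstract
    component : Subset n → Fin n → Subset n
    component U x = tabulate (λ v → does (reach? U x v))

    component⁺ : ∀ {U x v} → Reach G U x v → v ∈ component U x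
    component⁺ {U} {x} {v} walk =
      lookup⇒[]= v (component U x) (trans (lookup∘tabulate _ v) (dec-true (reach? U x v) walk))

    component⁻ : ∀ {U x v} → v ∈ component U x → Reach G U x v
    component⁻ {U} {x} {v} v∈C = witness (reach? U x v) (trans (sym (lookup∘tabulate _ v)) ([]=⇒lookup v∈C))
      where
      witness : (r : Dec (Reach G U x v)) → does r ≡ true → Reach G U x v
      witness (yes walk) _ = walk
      witness (no _) ()

  within-component : ∀ {U x y} → Reach G U x y → Reach G (component U x) x y
  within-component walk = go walk (here (start∈ walk))
    where
    go : ∀ {U x₀ x y} → Reach G U x y → Reach G U x₀ x → Reach G (component U x₀) x y
    go (here _) x₀→x = here (component⁺ x₀→x)
    go (step _ x~y walk) x₀→x = step (component⁺ x₀→x) x~y (go walk (reach-snoc x₀→x x~y (start∈ walk)))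

-- Part(S) consists of the sets  component of e in G - S, together with S.
module Parts (G : Graph) (S : Subset (Graph.n G)) where
  open Graph G using (n)
  open Walks G

  partOf : Fin n → Subset n
  partOf e = component (⊤ ─ S) e ∪ S

  S⊆partOf : ∀ {e} → S ⊆ partOf e
  S⊆partOf s∈S = x∈p∪q⁺ (inj₂ s∈S)

  component⊆partOf : ∀ {e} → component (⊤ ─ S) e ⊆ partOf e
  component⊆partOf v∈C = x∈p∪q⁺ (inj₁ v∈C)

  reach⇒∈partOf : ∀ {e v} → Reach G (⊤ ─ S) e v → v ∈ partOf e
  reach⇒∈partOf e→v = component⊆partOf (component⁺ e→v)

  ∈partOf : ∀ {e} → e ∉ S → e ∈ partOf e
  ∈partOf e∉S = reach⇒∈partOf (here (∉⇒∈∁ e∉S))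

  ∈partOf⇒reach : ∀ {e v} → v ∈ partOf e → v ∉ S → Reach G (⊤ ─ S) e v
  ∈partOf⇒reach {e} v∈ v∉S with x∈p∪q⁻ (component (⊤ ─ S) e) S v∈
  ... | inj₁ v∈C = component⁻ v∈C
  ... | inj₂ v∈S = ⊥-elim (v∉S v∈S)

  partOf-isPart : ∀ {e} → e ∉ S → Part G S (partOf e)
  partOf-isPart {e} e∉S = not-split , separated
    where
    not-split : ¬ Splits G ⊤ S (partOf e)
    not-split (x , y , x∈ , y∈ , ¬x→y) =
      ¬x→y (reach-trans (reach-sym (∈partOf⇒reach (p─q⊆p _ _ x∈) (∈─⇒∉ _ _ x∈)))
                        (∈partOf⇒reach (p─q⊆p _ _ y∈) (∈─⇒∉ _ _ y∈)))
    separated : ∀ x → x ∉ partOf e → Separates G ⊤ S ⁅ x ⁆ (partOf e)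
    separated x x∉ = (λ ⁅x⁆⊆S → x∉ (S⊆partOf (⁅x⁆⊆S (x∈⁅x⁆ x))))
                   , (λ part⊆S → e∉S (part⊆S (∈partOf e∉S)))
                   , no-walk
      where
      no-walk : ∀ u w → u ∈ ⁅ x ⁆ ─ S → w ∈ partOf e ─ S → ¬ Reach G (⊤ ─ S) u w
      no-walk u w u∈ w∈ u→w with x∈⁅y⁆⇒x≡y x (p─q⊆p _ _ u∈)
      ... | refl = x∉ (reach⇒∈partOf (reach-trans (∈partOf⇒reach (p─q⊆p _ _ w∈) (∈─⇒∉ _ _ w∈))
                                                    (reach-sym u→w)))

  -- A part contains S, since no vertex of S can be separated from it by S.
  S⊆part : ∀ {A} → Part G S A → S ⊆ A
  S⊆part {A} (_ , separated) {s} s∈S with s ∈? A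
  ... | yes s∈A = s∈A
  ... | no s∉A = ⊥-elim (proj₁ (separated s s∉A) (⁅⁆⊆ s∈S))

  part-closed : ∀ {A w v} → Part G S A → w ∈ A → w ∉ S → Reach G (⊤ ─ S) w v → v ∈ A
  part-closed {A} {w} {v} (_ , separated) w∈A w∉S w→v with v ∈? A
  ... | yes v∈A = v∈A
  ... | no v∉A = ⊥-elim (proj₂ (proj₂ (separated v v∉A)) v w
                          (x∈p∧x∉q⇒x∈p─q (x∈⁅x⁆ v) (∈∁⇒∉ (end∈ w→v)))
                          (x∈p∧x∉q⇒x∈p─q w∈A w∉S) (reach-sym w→v))

  part-unique : ∀ {A e} → Part G S A → e ∈ A → e ∉ S → A ≡ partOf e
  part-unique {A} {e} P@(not-split , _) e∈A e∉S = ⊆-antisym A⊆ ⊆A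
    where
    A⊆ : A ⊆ partOf e
    A⊆ {v} v∈A with v ∈? S
    ... | yes v∈S = S⊆partOf v∈S
    ... | no v∉S with reach? (⊤ ─ S) e v
    ...   | yes e→v = reach⇒∈partOf e→v
    ...   | no ¬e→v = ⊥-elim (not-split (e , v , x∈p∧x∉q⇒x∈p─q e∈A e∉S , x∈p∧x∉q⇒x∈p─q v∈A v∉S , ¬e→v))
    ⊆A : partOf e ⊆ A
    ⊆A {v} v∈ with x∈p∪q⁻ (component (⊤ ─ S) e) S v∈
    ... | inj₁ v∈C = part-closed P e∈A e∉S (component⁻ v∈C)
    ... | inj₂ v∈S = S⊆part P v∈S

  part-meets : ∀ {A x} → Part G S A → x ∉ S → ∃[ w ] (w ∈ A × w ∉ S)
  part-meets {A} {x} (_ , separated) x∉S with x ∈? A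
  ... | yes x∈A = x , x∈A , x∉S
  ... | no x∉A = ⊈⇒∃ (proj₁ (proj₂ (separated x x∉A)))

  module TwoComponents {c d : Fin n} (c∉S : c ∉ S) (d∉S : d ∉ S)
           (¬c→d : ¬ Reach G (⊤ ─ S) c d)
           (covers : ∀ v → v ∉ S → Reach G (⊤ ─ S) v c ⊎ Reach G (⊤ ─ S) v d) where

    parts-are : ∀ {A} → Part G S A → A ≡ partOf c ⊎ A ≡ partOf d
    parts-are P with part-meets P c∉S
    ... | w , w∈A , w∉S with covers w w∉S
    ...   | inj₁ w→c = inj₁ (part-unique P (part-closed P w∈A w∉S w→c) c∉S)
    ...   | inj₂ w→d = inj₂ (part-unique P (part-closed P w∈A w∉S w→d) d∉S)

    exactly-two-parts : HasExactlyTwo G (Part G S)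
    exactly-two-parts = partOf c , partOf d , distinct , partOf-isPart c∉S , partOf-isPart d∉S
                      , λ _ → parts-are
      where
      distinct : partOf c ≢ partOf d
      distinct c≡d = ¬c→d (reach-sym (∈partOf⇒reach (subst (c ∈_) c≡d (∈partOf c∉S)) c∉S))

module Cutsets (G : Graph) where
  open Graph G using (n)
  open Walks G

  CutpointFree : Set
  CutpointFree = ∀ v x y → x ≢ v → y ≢ v → Reach G (⊤ ─ ⁅ v ⁆) x y

  biconnected⇒cutpointFree : Biconnected G ⊤ → CutpointFree
  biconnected⇒cutpointFree (_ , no-small-cutset) v x y x≢v y≢v with reach? (⊤ ─ ⁅ v ⁆) x y
  ... | yes walk = walk
  ... | no ¬walk = ⊥-elim (no-small-cutset ⁅ v ⁆ (≤-reflexive (∣⁅x⁆∣≡1 v))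
                     ((λ _ → ∈⊤) , x , y , ∉⇒∈∁ (x≢y⇒x∉⁅y⁆ x≢v) , ∉⇒∈∁ (x≢y⇒x∉⁅y⁆ y≢v) , ¬walk))

  -- In a graph without cutpoints every part of a cutset S = {a, b} (a ≢ b) is
  -- connected: a walk from e ∉ S to a that avoids b enters S first at a, so
  -- up to there it stays in the component of e in G - S.
  part-connected : CutpointFree → ∀ {S : Subset n} {a b e} → IsPair S a b → a ≢ b → e ∉ S →
    Connected G (Parts.partOf G S e)
  part-connected cutpoint-free {S} {a} {b} {e} S-pair a≢b e∉S x y x∈A y∈A =
    reach-trans (reach-sym (reaches-all x x∈A)) (reaches-all y y∈A)
    where
    open Parts G S
    e≢ : ∀ {s} → s ∈ S → e ≢ s
    e≢ s∈S refl = e∉S s∈S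
    reaches-S : ∀ {x y} → IsPair S x y → x ≢ y → Reach G (partOf e) e x
    reaches-S {x} {y} P x≢y
      with first-entry {X = ⁅ x ⁆} (cutpoint-free y e x (e≢ (right∈ P)) x≢y)
                       (x≢y⇒x∉⁅y⁆ (e≢ (left∈ P))) (x∈⁅x⁆ x)
    ... | z , u , z∈⁅x⁆ , e→u , u~z rewrite x∈⁅y⁆⇒x≡y x z∈⁅x⁆ =
      reach-snoc (reach-mono component⊆partOf (within-component (reach-mono avoids-S e→u)))
                 u~z (S⊆partOf (left∈ P))
      where
      avoids-S : (⊤ ─ ⁅ y ⁆) ─ ⁅ x ⁆ ⊆ ⊤ ─ S
      avoids-S w∈ = ∉⇒∈∁ (∉-pair P (x∉⁅y⁆⇒x≢y (∈─⇒∉ _ _ w∈)) (x∉⁅y⁆⇒x≢y (∈─⇒∉ _ _ (p─q⊆p _ _ w∈))))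
    reaches-all : ∀ x → x ∈ partOf e → Reach G (partOf e) e x
    reaches-all x x∈A with x ∈? S
    ... | no x∉S = reach-mono component⊆partOf (within-component (∈partOf⇒reach x∈A x∉S))
    ... | yes x∈S with members S-pair x∈S
    ...   | inj₁ refl = reaches-S S-pair a≢b
    ...   | inj₂ refl = reaches-S (swap S-pair) (λ b≡a → a≢b (sym b≡a))

  SeparatedByPair : Subset n → Fin n → Fin n → Set
  SeparatedByPair S a b = ∃[ c ] ∃[ d ] (c ∉ S × d ∉ S × ¬ Reach G (⊤ ─ (⁅ c ⁆ ∪ ⁅ d ⁆)) a b)

  SeparatingCutpoint : Subset n → Fin n → Fin n → Set
  SeparatingCutpoint A a b = ∃[ x ] (Cutpoint G A x × Separates G A ⁅ x ⁆ ⁅ a ⁆ ⁅ b ⁆)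

  TwoPartsWithCutpoints : Subset n → Fin n → Fin n → Set
  TwoPartsWithCutpoints S a b =
    HasExactlyTwo G (Part G S) × (∀ A → Part G S A → ¬ Biconnected G A × SeparatingCutpoint A a b)

  module Crossing (cutpoint-free : CutpointFree) {S T : Subset n} {a b c d : Fin n}
                  (S-pair : IsPair S a b) (T-pair : IsPair T c d) (c∉S : c ∉ S) (d∉S : d ∉ S)
                  (T-separates : ¬ Reach G (⊤ ─ T) a b) where

    S∩T=∅ : ∀ {z} → z ∈ S → z ∉ T
    S∩T=∅ = disjoint-pairs S-pair T-pair c∉S d∉S

    -- If v (outside S ∪ T) cannot reach x ∈ S = {x, y} avoiding T, follow a
    -- walk from v to c avoiding y: it meets T before x, and avoids S until then.
    reaches-T-from : ∀ {x y v} → IsPair S x y → v ∉ S → v ∉ T → ¬ Reach G (⊤ ─ T) v x →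
      Reach G (⊤ ─ S) v c ⊎ Reach G (⊤ ─ S) v d
    reaches-T-from {x} {y} {v} P v∉S v∉T ¬v→x =
      through (first-entry (cutpoint-free y v c (≢y v∉S) (≢y c∉S)) v∉x∪T (x∈p∪q⁺ (inj₂ (left∈ T-pair))))
      where
      ≢y : ∀ {u} → u ∉ S → u ≢ y
      ≢y u∉S refl = u∉S (right∈ P)
      v∉x∪T : v ∉ ⁅ x ⁆ ∪ T
      v∉x∪T v∈ with x∈p∪q⁻ ⁅ x ⁆ T v∈
      ... | inj₁ v∈⁅x⁆ = v∉S (subst (_∈ S) (sym (x∈⁅y⁆⇒x≡y x v∈⁅x⁆)) (left∈ P))
      ... | inj₂ v∈T = v∉T v∈T
      W : Subset n
      W = (⊤ ─ ⁅ y ⁆) ─ (⁅ x ⁆ ∪ T)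
      W-avoids-T : W ⊆ ⊤ ─ T
      W-avoids-T w∈W = ∉⇒∈∁ (λ w∈T → ∈─⇒∉ _ _ w∈W (x∈p∪q⁺ (inj₂ w∈T)))
      W-avoids-S : W ⊆ ⊤ ─ S
      W-avoids-S w∈W = ∉⇒∈∁ (∉-pair P (λ { refl → ∈─⇒∉ _ _ w∈W (x∈p∪q⁺ (inj₁ (x∈⁅x⁆ x))) })
                                       (λ { refl → ∈─⇒∉ _ _ (p─q⊆p _ _ w∈W) (x∈⁅x⁆ y) }))
      through : ∃[ z ] ∃[ u ] (z ∈ ⁅ x ⁆ ∪ T × Reach G W v u × Adj G u z) →
        Reach G (⊤ ─ S) v c ⊎ Reach G (⊤ ─ S) v d
      through (z , u , z∈x∪T , v→u , u~z) with x∈p∪q⁻ ⁅ x ⁆ T z∈x∪T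
      ... | inj₁ z∈⁅x⁆ rewrite x∈⁅y⁆⇒x≡y x z∈⁅x⁆ =
            ⊥-elim (¬v→x (reach-snoc (reach-mono W-avoids-T v→u) u~z (∉⇒∈∁ (S∩T=∅ (left∈ P)))))
      ... | inj₂ z∈T with members T-pair z∈T
      ...   | inj₁ refl = inj₁ (reach-snoc (reach-mono W-avoids-S v→u) u~z (∉⇒∈∁ c∉S))
      ...   | inj₂ refl = inj₂ (reach-snoc (reach-mono W-avoids-S v→u) u~z (∉⇒∈∁ d∉S))

    -- Every vertex outside S is joined to c or to d in G - S: it cannot reach
    -- both a and b avoiding T, since T separates them.
    reaches-T : ∀ v → v ∉ S → Reach G (⊤ ─ S) v c ⊎ Reach G (⊤ ─ S) v d
    reaches-T v v∉S with v ∈? T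
    ... | yes v∈T with members T-pair v∈T
    ...   | inj₁ refl = inj₁ (here (∉⇒∈∁ v∉S))
    ...   | inj₂ refl = inj₂ (here (∉⇒∈∁ v∉S))
    reaches-T v v∉S | no v∉T with reach? (⊤ ─ T) v a
    ... | no ¬v→a = reaches-T-from S-pair v∉S v∉T ¬v→a
    ... | yes v→a = reaches-T-from (swap S-pair) v∉S v∉T (λ v→b → T-separates (reach-trans (reach-sym v→a) v→b))

    cutset-separates-T : Cutset G ⊤ S → ¬ Reach G (⊤ ─ S) c d
    cutset-separates-T (_ , x , y , x∈ , y∈ , ¬x→y) c→d =
      ¬x→y (reach-trans (to-c x x∈) (reach-sym (to-c y y∈)))
      where
      to-c : ∀ v → v ∈ ⊤ ─ S → Reach G (⊤ ─ S) v c
      to-c v v∈ with reaches-T v (∈∁⇒∉ v∈)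
      ... | inj₁ v→c = v→c
      ... | inj₂ v→d = reach-trans v→d (reach-sym c→d)

    open Parts G S

    -- If moreover S separates c from d (and a ≢ b), then c is a cutpoint of the
    -- part of c that separates a from b there: d is not in that part, so
    -- removing c leaves only walks avoiding T, and T separates a from b.
    cutpoint-in-part : a ≢ b → ¬ Reach G (⊤ ─ S) c d → SeparatingCutpoint (partOf c) a b
    cutpoint-in-part a≢b ¬c→d =
      c , (part-connected cutpoint-free S-pair a≢b c∉S , ∈partOf c∉S , cut) , separates
      where
      A : Subset n
      A = partOf c
      ≢c : ∀ {s} → s ∈ S → s ≢ c
      ≢c s∈S refl = c∉S s∈S
      A-c-avoids-T : A ─ ⁅ c ⁆ ⊆ ⊤ ─ T
      A-c-avoids-T {w} w∈ = ∉⇒∈∁ (∉-pair T-pair (x∉⁅y⁆⇒x≢y (∈─⇒∉ _ _ w∈)) w≢d)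
        where
        w≢d : w ≢ d
        w≢d refl = ¬c→d (∈partOf⇒reach (p─q⊆p _ _ w∈) d∉S)
      ¬a→b : ¬ Reach G (A ─ ⁅ c ⁆) a b
      ¬a→b a→b = T-separates (reach-mono A-c-avoids-T a→b)
      a∈A-c : a ∈ A ─ ⁅ c ⁆
      a∈A-c = x∈p∧x∉q⇒x∈p─q (S⊆partOf (left∈ S-pair)) (x≢y⇒x∉⁅y⁆ (≢c (left∈ S-pair)))
      b∈A-c : b ∈ A ─ ⁅ c ⁆
      b∈A-c = x∈p∧x∉q⇒x∈p─q (S⊆partOf (right∈ S-pair)) (x≢y⇒x∉⁅y⁆ (≢c (right∈ S-pair)))
      cut : Cutset G A ⁅ c ⁆
      cut = ⁅⁆⊆ (∈partOf c∉S) , a , b , a∈A-c , b∈A-c , ¬a→b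
      separates : Separates G A ⁅ c ⁆ ⁅ a ⁆ ⁅ b ⁆
      separates = (λ ⁅a⁆⊆⁅c⁆ → ∈─⇒∉ _ _ a∈A-c (⁅a⁆⊆⁅c⁆ (x∈⁅x⁆ a)))
                , (λ ⁅b⁆⊆⁅c⁆ → ∈─⇒∉ _ _ b∈A-c (⁅b⁆⊆⁅c⁆ (x∈⁅x⁆ b)))
                , λ { x y x∈ y∈ → only-a-b (x∈⁅y⁆⇒x≡y a (p─q⊆p _ _ x∈)) (x∈⁅y⁆⇒x≡y b (p─q⊆p _ _ y∈)) }
        where
        only-a-b : ∀ {x y} → x ≡ a → y ≡ b → ¬ Reach G (A ─ ⁅ c ⁆) x y
        only-a-b refl refl = ¬a→b

  cutpoint⇒¬biconnected : ∀ {A x} → Cutpoint G A x → ¬ Biconnected G A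
  cutpoint⇒¬biconnected {x = x} (_ , _ , cut) (_ , no-small-cutset) =
    no-small-cutset ⁅ x ⁆ (≤-reflexive (∣⁅x⁆∣≡1 x)) cut

  crossed-cutset : CutpointFree → ∀ {S : Subset n} {a b} →
    IsPair S a b → a ≢ b → Cutset G ⊤ S → SeparatedByPair S a b → TwoPartsWithCutpoints S a b
  crossed-cutset cutpoint-free {S} {a} {b} S-pair a≢b S-cut (c , d , c∉S , d∉S , T-separates) =
    exactly-two-parts , λ A A-part → with-cutpoint (parts-are A-part)
    where
    T-pair : IsPair (⁅ c ⁆ ∪ ⁅ d ⁆) c d
    T-pair = ⁅⁆∪⁅⁆-isPair c d
    open Crossing cutpoint-free S-pair T-pair c∉S d∉S T-separates
    open Parts G S
    ¬c→d : ¬ Reach G (⊤ ─ S) c d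
    ¬c→d = cutset-separates-T S-cut
    open TwoComponents c∉S d∉S ¬c→d reaches-T
    conclude : ∀ {A} → SeparatingCutpoint A a b → ¬ Biconnected G A × SeparatingCutpoint A a b
    conclude x@(_ , x-cutpoint , _) = cutpoint⇒¬biconnected x-cutpoint , x
    with-cutpoint : ∀ {A} → A ≡ partOf c ⊎ A ≡ partOf d → ¬ Biconnected G A × SeparatingCutpoint A a b
    with-cutpoint (inj₁ refl) = conclude (cutpoint-in-part a≢b ¬c→d)
    with-cutpoint (inj₂ refl) =
      conclude (Crossing.cutpoint-in-part cutpoint-free S-pair (swap T-pair) d∉S c∉S T-separates
                  a≢b (λ d→c → ¬c→d (reach-sym d→c)))

  -- Either some pair {c, d} outside S = {a, b} separates a from b, or S is
  -- single: otherwise a cutset T = {c, d} would split S or be split by S, and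
  -- either way some pair would cross S (the second case by symmetry of crossing).
  crossed-or-single : CutpointFree → ∀ {S : Subset n} {a b} → IsPair S a b →
    SeparatedByPair S a b ⊎ Single G S
  crossed-or-single cutpoint-free {S} {a} {b} S-pair
    with any? (λ c → any? (λ d → ¬? (c ∈? S) ×-dec ¬? (d ∈? S) ×-dec ¬? (reach? (⊤ ─ (⁅ c ⁆ ∪ ⁅ d ⁆)) a b)))
  ... | yes crossing = inj₁ crossing
  ... | no no-crossing = inj₂ single
    where
    joined : ∀ {T c d} → IsPair T c d → c ∉ S → d ∉ S → Reach G (⊤ ─ T) a b
    joined {c = c} {d} T-pair c∉S d∉S with reach? (⊤ ─ (⁅ c ⁆ ∪ ⁅ d ⁆)) a b
    ... | yes a→b = reach-mono (∁⁅⁆∪⁅⁆⊆∁ T-pair) a→b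
    ... | no ¬a→b = ⊥-elim (no-crossing (c , d , c∉S , d∉S , ¬a→b))
    single : Single G S
    single T (T-cut , ∣T∣≡2) _ with ∣∣≡2⇒pair T ∣T∣≡2
    ... | c , d , _ , T-pair = S-splits-not-T , T-splits-not-S
      where
      T-splits-not-S : ¬ Splits G ⊤ T S
      T-splits-not-S = pair-unsplit S-pair λ a∉T b∉T ¬a→b →
        let S∩T=∅ = disjoint-pairs T-pair S-pair a∉T b∉T
        in ¬a→b (joined T-pair (S∩T=∅ (left∈ T-pair)) (S∩T=∅ (right∈ T-pair)))
      S-splits-not-T : ¬ Splits G ⊤ S T
      S-splits-not-T = pair-unsplit T-pair λ c∉S d∉S ¬c→d →
        let T∩S=∅ = disjoint-pairs S-pair T-pair c∉S d∉S
        in Crossing.cutset-separates-T cutpoint-free T-pair S-pair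
             (T∩S=∅ (left∈ S-pair)) (T∩S=∅ (right∈ S-pair)) ¬c→d T-cut (joined T-pair c∉S d∉S)

open Cutsets using (biconnected⇒cutpointFree; crossed-cutset; crossed-or-single)

lemma6 : (G : Graph) (a b : Fin (Graph.n G)) →
    Biconnected G ⊤ →
    R₂ G (⁅ a ⁆ ∪ ⁅ b ⁆) →
    ¬ Single G (⁅ a ⁆ ∪ ⁅ b ⁆) →
    HasExactlyTwo G (Part G (⁅ a ⁆ ∪ ⁅ b ⁆)) ×
    (∀ A → Part G (⁅ a ⁆ ∪ ⁅ b ⁆) A →
    ¬ Biconnected G A ×
    ∃[ x ] (Cutpoint G A x × Separates G A ⁅ x ⁆ ⁅ a ⁆ ⁅ b ⁆))
lemma6 G a b biconnected (S-cut , ∣S∣≡2) ¬single =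
  [ crossed-cutset G cutpoint-free S-pair (pair-distinct S-pair ∣S∣≡2) S-cut
  , (λ single → ⊥-elim (¬single single)) ]′ (crossed-or-single G cutpoint-free S-pair)
  where
  cutpoint-free : Cutsets.CutpointFree G
  cutpoint-free = biconnected⇒cutpointFree G biconnected
  S-pair : IsPair (⁅ a ⁆ ∪ ⁅ b ⁆) a b
  S-pair = ⁅⁆∪⁅⁆-isPair a b
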